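{- For all non-negative integers $k$ and $n$, $$F_k^3\sum_{j=0}^n(-1)^{(k+1)(n+j)}\,j\binom{n+j}{2j}L_k^{2j}=\frac{1}{10}\Big((2n+1)F_{2k}L_{(2n+1)k}-F_{(2n+1)k}L_k^2\Big).$$
   Context: $F_j$ and $L_j$ denote the Fibonacci and Lucas numbers ($F_0=0,F_1=1$, $L_0=2,L_1=1$, both satisfying $X_j=X_{j-1}+X_{j-2}$). -}

module Defs where

open import Data.Nat using (ℕ; zero; suc)
open import Data.Nat.Combinatorics using (_C_)
open import Data.Integer using (ℤ; +_; _+_; _*_; -_; _^_)

fib : ℕ → ℕ
fib zero = 0
fib (suc zero) = 1
fib (suc (suc n)) = fib (suc n) Data.Nat.+ fib n

lucas : ℕ → ℕ
lucas zero = 2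
lucas (suc zero) = 1
lucas (suc (suc n)) = lucas (suc n) Data.Nat.+ lucas n

sgn : ℕ → ℤ
sgn m = (- (+ 1)) ^ m

sumTo : ℕ → (ℕ → ℤ) → ℤ
sumTo zero f = f 0
sumTo (suc n) f = sumTo n f + f (suc n)

-- Put s = (-1)^(k+1), x = L_k and
--   B n = Σ_j s^(n+j) C(n+j,2j) x^(2j),   S n = Σ_j j s^(n+j) C(n+j,2j) x^(2j),
-- so that the left-hand side is 10 F_k³ S n.  Applying Pascal's rule twice to the
-- summands, and using s² = 1 and 2s + x² = L_{2k}, gives
--   B (n+2) + B n = L_{2k} B (n+1),   S (n+2) + S n = L_{2k} S (n+1) + x² B (n+1).
-- Every Fibonacci-like sequence satisfies X_{m+2d} = L_d X_{m+d} - (-1)^d X_m, so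
-- with d = 2k the values F_{(2n+1)k} and L_{(2n+1)k} obey the same recurrence as B;
-- hence F_k B n = F_{(2n+1)k}.  Together with L_{m+4k} - L_m = 5 F_{2k} F_{m+2k}, both
-- sides of the theorem then satisfy u (n+2) + u n = L_{2k} u (n+1) + 10 F_{2k}² F_{(2n+3)k},
-- and they agree for n = 0 and n = 1.

module Submission where

open import Defs
open import Data.Nat using (ℕ; zero; suc; _<_; s≤s)
open import Data.Nat.Combinatorics using (_C_; nCk+nC[k+1]≡[n+1]C[k+1]; k>n⇒nCk≡0)
open import Data.Integer using (ℤ; +_; _+_; _*_; _-_; _^_; -_; 0ℤ; 1ℤ)
open import Data.Integer.Properties
  using (pos-+; +-assoc; +-identityʳ; *-identityʳ; *-identityˡ; *-zeroʳ; *-zeroˡ; *-distribˡ-+;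
         ^-*-assoc; ^-zeroˡ; +-0-abelianGroup)
open import Data.Integer.Tactic.RingSolver using (solve-∀; solve)
open import Data.List using (_∷_; [])
open import Data.Product using (_×_; _,_; proj₁)
open import Algebra.Bundles using (AbelianGroup)
open import Algebra.Properties.Group (AbelianGroup.group +-0-abelianGroup) using (∙-cancelʳ)
open import Relation.Binary.PropositionalEquality
  using (_≡_; refl; sym; trans; cong; cong₂; subst; module ≡-Reasoning)
import Data.Nat as ℕ
import Data.Nat.Properties as ℕ
import Data.Nat.Tactic.RingSolver as ℕ

open ≡-Reasoning

sumTo-cong : ∀ n {f g : ℕ → ℤ} → (∀ j → f j ≡ g j) → sumTo n f ≡ sumTo n g
sumTo-cong zero    f≗g = f≗g 0
sumTo-cong (suc n) f≗g = cong₂ _+_ (sumTo-cong n f≗g) (f≗g (suc n))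

sumTo-+ : ∀ n (f g : ℕ → ℤ) → sumTo n (λ j → f j + g j) ≡ sumTo n f + sumTo n g
sumTo-+ zero    f g = refl
sumTo-+ (suc n) f g = begin
  sumTo n (λ j → f j + g j) + (f (suc n) + g (suc n))
    ≡⟨ cong (_+ (f (suc n) + g (suc n))) (sumTo-+ n f g) ⟩
  (sumTo n f + sumTo n g) + (f (suc n) + g (suc n))
    ≡⟨ interchange (sumTo n f) (sumTo n g) (f (suc n)) (g (suc n)) ⟩
  (sumTo n f + f (suc n)) + (sumTo n g + g (suc n)) ∎
  where
  interchange : ∀ a b c d → (a + b) + (c + d) ≡ (a + c) + (b + d)
  interchange = solve-∀

sumTo-*ˡ : ∀ n a (f : ℕ → ℤ) → sumTo n (λ j → a * f j) ≡ a * sumTo n f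
sumTo-*ˡ zero    a f = refl
sumTo-*ˡ (suc n) a f =
  trans (cong (_+ a * f (suc n)) (sumTo-*ˡ n a f)) (sym (*-distribˡ-+ a (sumTo n f) (f (suc n))))

sumTo-suc : ∀ n (f : ℕ → ℤ) → sumTo (suc n) f ≡ f 0 + sumTo n (λ j → f (suc j))
sumTo-suc zero    f = refl
sumTo-suc (suc n) f = trans (cong (_+ f (suc (suc n))) (sumTo-suc n f)) (+-assoc (f 0) _ _)

sumTo-extend : ∀ n {f : ℕ → ℤ} → f (suc n) ≡ 0ℤ → sumTo (suc n) f ≡ sumTo n f
sumTo-extend n {f} f[1+n]≡0 = trans (cong (_+_ (sumTo n f)) f[1+n]≡0) (+-identityʳ (sumTo n f))

-- For a triangular array (f n j = 0 when j > n), a recurrence between entries of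
-- consecutive rows passes to the row sums Σ_{j ≤ n} f n j.
sumTo-diagonal-rec : ∀ (f g : ℕ → ℕ → ℤ) (α β : ℤ) →
  (∀ {n j} → n < j → f n j ≡ 0ℤ) →
  (∀ n → f (suc (suc n)) 0 + α * f n 0 ≡ β * f (suc n) 0) →
  (∀ n j → f (suc (suc n)) (suc j) + α * f n (suc j) ≡ β * f (suc n) (suc j) + g n j) →
  ∀ n → sumTo (suc (suc n)) (f (suc (suc n))) + α * sumTo n (f n)
      ≡ β * sumTo (suc n) (f (suc n)) + sumTo (suc n) (g n)
sumTo-diagonal-rec f g α β vanish head step n = begin
  sumTo (suc (suc n)) f₂ + α * sumTo n f₀
    ≡⟨ cong (λ z → sumTo (suc (suc n)) f₂ + α * z) (sym f₀-padded) ⟩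
  sumTo (suc (suc n)) f₂ + α * sumTo (suc (suc n)) f₀
    ≡⟨ cong₂ (λ u v → u + α * v) (sumTo-suc (suc n) f₂) (sumTo-suc (suc n) f₀) ⟩
  (f₂ 0 + tail f₂) + α * (f₀ 0 + tail f₀)
    ≡⟨ regroup (f₂ 0) (tail f₂) (f₀ 0) (tail f₀) α ⟩
  (f₂ 0 + α * f₀ 0) + (tail f₂ + α * tail f₀)
    ≡⟨ cong₂ _+_ (head n) (sym tails) ⟩
  β * f₁ 0 + sumTo (suc n) (λ j → f₂ (suc j) + α * f₀ (suc j))
    ≡⟨ cong (_+_ (β * f₁ 0)) (sumTo-cong (suc n) (step n)) ⟩
  β * f₁ 0 + sumTo (suc n) (λ j → β * f₁ (suc j) + g n j)
    ≡⟨ cong (_+_ (β * f₁ 0))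
            (trans (sumTo-+ (suc n) _ (g n)) (cong (_+ sumTo (suc n) (g n)) (sumTo-*ˡ (suc n) β _))) ⟩
  β * f₁ 0 + (β * tail f₁ + sumTo (suc n) (g n))
    ≡⟨ factor β (f₁ 0) (tail f₁) (sumTo (suc n) (g n)) ⟩
  β * (f₁ 0 + tail f₁) + sumTo (suc n) (g n)
    ≡⟨ cong (λ z → β * z + sumTo (suc n) (g n)) (trans (sym (sumTo-suc (suc n) f₁)) f₁-padded) ⟩
  β * sumTo (suc n) f₁ + sumTo (suc n) (g n) ∎
  where
  f₀ f₁ f₂ : ℕ → ℤ
  f₀ = f n
  f₁ = f (suc n)
  f₂ = f (suc (suc n))
  tail : (ℕ → ℤ) → ℤ
  tail h = sumTo (suc n) (λ j → h (suc j))
  tails : sumTo (suc n) (λ j → f₂ (suc j) + α * f₀ (suc j)) ≡ tail f₂ + α * tail f₀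
  tails = trans (sumTo-+ (suc n) _ _) (cong (_+_ (tail f₂)) (sumTo-*ˡ (suc n) α _))
  f₀-padded : sumTo (suc (suc n)) f₀ ≡ sumTo n f₀
  f₀-padded = trans (sumTo-extend (suc n) (vanish (s≤s (ℕ.n≤1+n n)))) (sumTo-extend n (vanish (ℕ.n<1+n n)))
  f₁-padded : sumTo (suc (suc n)) f₁ ≡ sumTo (suc n) f₁
  f₁-padded = sumTo-extend (suc n) (vanish (ℕ.n<1+n (suc n)))
  regroup : ∀ a b c d α → (a + b) + α * (c + d) ≡ (a + α * c) + (b + α * d)
  regroup = solve-∀
  factor : ∀ β a b c → β * a + (β * b + c) ≡ β * (a + b) + c
  factor = solve-∀

pascalℤ : ∀ n k → + (suc n C suc k) ≡ + (n C k) + + (n C suc k)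
pascalℤ n k = trans (cong +_ (sym (nCk+nC[k+1]≡[n+1]C[k+1] n k))) (pos-+ (n C k) (n C suc k))

pascal-twice : ∀ m r → + (suc (suc m) C suc (suc r)) + + (m C suc (suc r))
                     ≡ + (suc m C suc (suc r)) + + (suc m C suc (suc r)) + + (m C r)
pascal-twice m r = begin
  + (suc (suc m) C suc (suc r)) + + (m C suc (suc r))
    ≡⟨ cong (λ z → z + + (m C suc (suc r)))
            (trans (pascalℤ (suc m) (suc r)) (cong (λ z → z + + (suc m C suc (suc r))) (pascalℤ m r))) ⟩
  (+ (m C r) + + (m C suc r)) + + (suc m C suc (suc r)) + + (m C suc (suc r))
    ≡⟨ rearrange (+ (m C r)) (+ (m C suc r)) (+ (suc m C suc (suc r))) (+ (m C suc (suc r))) ⟩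
  + (suc m C suc (suc r)) + (+ (m C suc r) + + (m C suc (suc r))) + + (m C r)
    ≡⟨ cong (λ z → + (suc m C suc (suc r)) + z + + (m C r)) (sym (pascalℤ m (suc r))) ⟩
  + (suc m C suc (suc r)) + + (suc m C suc (suc r)) + + (m C r) ∎
  where
  rearrange : ∀ a b c d → (a + b) + c + d ≡ c + (b + d) + a
  rearrange = solve-∀

module BinomialSums (a t : ℤ) where

  term : ℕ → ℕ → ℤ
  term n j = a ^ (n ℕ.+ j) * + ((n ℕ.+ j) C (2 ℕ.* j)) * t ^ j

  weighted : ℕ → ℕ → ℤ
  weighted n j = + j * term n j

  B S : ℕ → ℤ
  B n = sumTo n (term n)
  S n = sumTo n (weighted n)

  term-vanishes : ∀ {n j} → n < j → term n j ≡ 0ℤ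
  term-vanishes {n} {j} n<j = begin
    a ^ (n ℕ.+ j) * + ((n ℕ.+ j) C (2 ℕ.* j)) * t ^ j
      ≡⟨ cong (λ c → a ^ (n ℕ.+ j) * + c * t ^ j) (k>n⇒nCk≡0 n+j<2j) ⟩
    a ^ (n ℕ.+ j) * 0ℤ * t ^ j
      ≡⟨ cong (_* t ^ j) (*-zeroʳ (a ^ (n ℕ.+ j))) ⟩
    0ℤ * t ^ j
      ≡⟨ *-zeroˡ (t ^ j) ⟩
    0ℤ ∎
    where
    n+j<2j : n ℕ.+ j < 2 ℕ.* j
    n+j<2j = subst (n ℕ.+ j <_) (cong (j ℕ.+_) (sym (ℕ.+-identityʳ j))) (ℕ.+-monoˡ-< j n<j)

  term-suc : ∀ n j → term n (suc j) ≡ a ^ suc (n ℕ.+ j) * + (suc (n ℕ.+ j) C suc (suc (2 ℕ.* j))) * t ^ suc j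
  term-suc n j = cong₂ (λ e i → a ^ e * + (e C i) * t ^ suc j) (ℕ.+-suc n j) (ℕ.*-suc 2 j)

  term-head : ∀ n → term (suc (suc n)) 0 + a * a * term n 0 ≡ (a + a) * term (suc n) 0
  term-head n = ring (a ^ (n ℕ.+ 0))
    where
    ring : ∀ A → a * (a * A) * + 1 * 1ℤ + a * a * (A * + 1 * 1ℤ) ≡ (a + a) * (a * A * + 1 * 1ℤ)
    ring A = solve (a ∷ A ∷ [])

  term-rec : ∀ n j → term (suc (suc n)) (suc j) + a * a * term n (suc j)
                   ≡ (a + a) * term (suc n) (suc j) + a * a * t * term (suc n) j
  term-rec n j = begin
    term (suc (suc n)) (suc j) + a * a * term n (suc j)
      ≡⟨ cong₂ (λ u v → u + a * a * v) (term-suc (suc (suc n)) j) (term-suc n j) ⟩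
    a ^ suc (suc (suc m)) * c₀ * t ^ suc j + a * a * (a ^ suc m * c₂ * t ^ suc j)
      ≡⟨ factor (a ^ suc m) (t ^ j) c₀ c₂ ⟩
    a * a * (a ^ suc m * t ^ suc j) * (c₀ + c₂)
      ≡⟨ cong (λ z → a * a * (a ^ suc m * t ^ suc j) * z) (pascal-twice (suc m) (2 ℕ.* j)) ⟩
    a * a * (a ^ suc m * t ^ suc j) * (c₁ + c₁ + c₃)
      ≡⟨ unfactor (a ^ suc m) (t ^ j) c₁ c₃ ⟩
    (a + a) * (a ^ suc (suc m) * c₁ * t ^ suc j) + a * a * t * term (suc n) j
      ≡⟨ cong (λ u → (a + a) * u + a * a * t * term (suc n) j) (sym (term-suc (suc n) j)) ⟩
    (a + a) * term (suc n) (suc j) + a * a * t * term (suc n) j ∎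
    where
    m : ℕ
    m = n ℕ.+ j
    c₀ c₁ c₂ c₃ : ℤ
    c₀ = + (suc (suc (suc m)) C suc (suc (2 ℕ.* j)))
    c₁ = + (suc (suc m) C suc (suc (2 ℕ.* j)))
    c₂ = + (suc m C suc (suc (2 ℕ.* j)))
    c₃ = + (suc m C (2 ℕ.* j))
    factor : ∀ A T c₀ c₂ → a * (a * A) * c₀ * (t * T) + a * a * (A * c₂ * (t * T))
                         ≡ a * a * (A * (t * T)) * (c₀ + c₂)
    factor A T c₀ c₂ = solve (a ∷ t ∷ A ∷ T ∷ c₀ ∷ c₂ ∷ [])
    unfactor : ∀ A T c₁ c₃ → a * a * (A * (t * T)) * (c₁ + c₁ + c₃)
                           ≡ (a + a) * (a * A * c₁ * (t * T)) + a * a * t * (A * c₃ * T)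
    unfactor A T c₁ c₃ = solve (a ∷ t ∷ A ∷ T ∷ c₁ ∷ c₃ ∷ [])

  weighted-vanishes : ∀ {n j} → n < j → weighted n j ≡ 0ℤ
  weighted-vanishes {n} {j} n<j = trans (cong (λ z → + j * z) (term-vanishes n<j)) (*-zeroʳ (+ j))

  -- weighted m 0 = + 0 * term m 0 reduces to 0ℤ.
  weighted-head : ∀ n → weighted (suc (suc n)) 0 + a * a * weighted n 0 ≡ (a + a) * weighted (suc n) 0
  weighted-head n = solve (a ∷ [])

  weighted-rec : ∀ n j → weighted (suc (suc n)) (suc j) + a * a * weighted n (suc j)
                       ≡ (a + a) * weighted (suc n) (suc j) + a * a * t * (weighted (suc n) j + term (suc n) j)
  weighted-rec n j = begin
    + suc j * term (suc (suc n)) (suc j) + a * a * (+ suc j * term n (suc j))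
      ≡⟨ factor (+ j) (term (suc (suc n)) (suc j)) (term n (suc j)) ⟩
    (1ℤ + + j) * (term (suc (suc n)) (suc j) + a * a * term n (suc j))
      ≡⟨ cong (λ z → (1ℤ + + j) * z) (term-rec n j) ⟩
    (1ℤ + + j) * ((a + a) * term (suc n) (suc j) + a * a * t * term (suc n) j)
      ≡⟨ unfactor (+ j) (term (suc n) (suc j)) (term (suc n) j) ⟩
    (a + a) * (+ suc j * term (suc n) (suc j)) + a * a * t * (+ j * term (suc n) j + term (suc n) j) ∎
    where
    factor : ∀ J X Y → (1ℤ + J) * X + a * a * ((1ℤ + J) * Y) ≡ (1ℤ + J) * (X + a * a * Y)
    factor J X Y = solve (a ∷ J ∷ X ∷ Y ∷ [])
    unfactor : ∀ J X Y → (1ℤ + J) * ((a + a) * X + a * a * t * Y)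
                       ≡ (a + a) * ((1ℤ + J) * X) + a * a * t * (J * Y + Y)
    unfactor J X Y = solve (a ∷ t ∷ J ∷ X ∷ Y ∷ [])

  B-rec : ∀ n → B (suc (suc n)) + a * a * B n ≡ (a + a) * B (suc n) + a * a * t * B (suc n)
  B-rec n = trans (sumTo-diagonal-rec term (λ n j → a * a * t * term (suc n) j) (a * a) (a + a)
                                      term-vanishes term-head term-rec n)
                  (cong (λ z → (a + a) * B (suc n) + z) (sumTo-*ˡ (suc n) (a * a * t) (term (suc n))))

  S-rec : ∀ n → S (suc (suc n)) + a * a * S n
              ≡ (a + a) * S (suc n) + a * a * t * (S (suc n) + B (suc n))
  S-rec n = trans (sumTo-diagonal-rec weighted (λ n j → a * a * t * (weighted (suc n) j + term (suc n) j))
                                      (a * a) (a + a) weighted-vanishes weighted-head weighted-rec n)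
                  (cong (λ z → (a + a) * S (suc n) + z)
                        (trans (sumTo-*ˡ (suc n) (a * a * t) _)
                               (cong (λ z → a * a * t * z) (sumTo-+ (suc n) (weighted (suc n)) (term (suc n))))))

  B-one : B 1 ≡ a + a * a * t
  B-one = ring
    where
    ring : a * 1ℤ * + 1 * 1ℤ + a * (a * 1ℤ) * + 1 * (t * 1ℤ) ≡ a + a * a * t
    ring = solve (a ∷ t ∷ [])

  S-one : S 1 ≡ a * a * t
  S-one = ring
    where
    ring : 0ℤ + + 1 * (a * (a * 1ℤ) * + 1 * (t * 1ℤ)) ≡ a * a * t
    ring = solve (a ∷ t ∷ [])

fibℤ lucasℤ : ℕ → ℤ
fibℤ n = + fib n
lucasℤ n = + lucas n

record IsFibonacciLike (X : ℕ → ℤ) : Set where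
  field
    recurrence : ∀ n → X (suc (suc n)) ≡ X (suc n) + X n

open IsFibonacciLike using (recurrence)

fibℤ-isFibonacciLike : IsFibonacciLike fibℤ
fibℤ-isFibonacciLike = record { recurrence = λ n → pos-+ (fib (suc n)) (fib n) }

lucasℤ-isFibonacciLike : IsFibonacciLike lucasℤ
lucasℤ-isFibonacciLike = record { recurrence = λ n → pos-+ (lucas (suc n)) (lucas n) }

fibℤ-rec : ∀ n → fibℤ (suc (suc n)) ≡ fibℤ (suc n) + fibℤ n
fibℤ-rec = recurrence fibℤ-isFibonacciLike

lucasℤ-rec : ∀ n → lucasℤ (suc (suc n)) ≡ lucasℤ (suc n) + lucasℤ n
lucasℤ-rec = recurrence lucasℤ-isFibonacciLike

sgn-square : ∀ n → sgn n * sgn n ≡ 1ℤ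
sgn-square zero    = refl
sgn-square (suc n) = trans (ring (sgn n)) (sgn-square n)
  where
  ring : ∀ σ → (- 1ℤ * σ) * (- 1ℤ * σ) ≡ σ * σ
  ring σ = solve (σ ∷ [])

sgn-even : ∀ n → sgn (2 ℕ.* n) ≡ 1ℤ
sgn-even n = trans (sym (^-*-assoc (- 1ℤ) 2 n)) (^-zeroˡ n)

cassini : ∀ n → fibℤ n * fibℤ (suc (suc n)) - fibℤ (suc n) * fibℤ (suc n) ≡ sgn (suc n)
cassini zero    = refl
cassini (suc n) = begin
  b * fibℤ (suc (suc (suc n))) - c * c
    ≡⟨ cong (λ u → b * u - c * c) (fibℤ-rec (suc n)) ⟩
  b * (c + b) - c * c
    ≡⟨ cong (λ u → b * (u + b) - u * u) (fibℤ-rec n) ⟩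
  b * ((b + a) + b) - (b + a) * (b + a)
    ≡⟨ ring a b ⟩
  - 1ℤ * (a * (b + a) - b * b)
    ≡⟨ cong (λ u → - 1ℤ * (a * u - b * b)) (sym (fibℤ-rec n)) ⟩
  - 1ℤ * (a * c - b * b)
    ≡⟨ cong (λ u → - 1ℤ * u) (cassini n) ⟩
  - 1ℤ * sgn (suc n) ∎
  where
  a b c : ℤ
  a = fibℤ n
  b = fibℤ (suc n)
  c = fibℤ (suc (suc n))
  ring : ∀ a b → b * ((b + a) + b) - (b + a) * (b + a) ≡ - 1ℤ * (a * (b + a) - b * b)
  ring a b = solve (a ∷ b ∷ [])

lucasℤ-via-fibℤ : ∀ n → lucasℤ n ≡ + 2 * fibℤ (suc n) - fibℤ n
lucasℤ-via-fibℤ zero          = refl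
lucasℤ-via-fibℤ (suc zero)    = refl
lucasℤ-via-fibℤ (suc (suc n)) = begin
  lucasℤ (suc (suc n))
    ≡⟨ lucasℤ-rec n ⟩
  lucasℤ (suc n) + lucasℤ n
    ≡⟨ cong₂ _+_ (lucasℤ-via-fibℤ (suc n)) (lucasℤ-via-fibℤ n) ⟩
  (+ 2 * fibℤ (suc (suc n)) - fibℤ (suc n)) + (+ 2 * fibℤ (suc n) - fibℤ n)
    ≡⟨ ring (fibℤ (suc (suc n))) (fibℤ (suc n)) (fibℤ n) ⟩
  + 2 * (fibℤ (suc (suc n)) + fibℤ (suc n)) - (fibℤ (suc n) + fibℤ n)
    ≡⟨ cong₂ (λ u v → + 2 * u - v) (sym (fibℤ-rec (suc n))) (sym (fibℤ-rec n)) ⟩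
  + 2 * fibℤ (suc (suc (suc n))) - fibℤ (suc (suc n)) ∎
  where
  ring : ∀ u v w → (+ 2 * u - v) + (+ 2 * v - w) ≡ + 2 * (u + v) - (v + w)
  ring u v w = solve (u ∷ v ∷ w ∷ [])

fibℤ-via-lucasℤ : ∀ n → + 2 * lucasℤ (suc n) - lucasℤ n ≡ + 5 * fibℤ n
fibℤ-via-lucasℤ zero          = refl
fibℤ-via-lucasℤ (suc zero)    = refl
fibℤ-via-lucasℤ (suc (suc n)) = begin
  + 2 * lucasℤ (suc (suc (suc n))) - lucasℤ (suc (suc n))
    ≡⟨ cong₂ (λ u v → + 2 * u - v) (lucasℤ-rec (suc n)) (lucasℤ-rec n) ⟩
  + 2 * (lucasℤ (suc (suc n)) + lucasℤ (suc n)) - (lucasℤ (suc n) + lucasℤ n)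
    ≡⟨ ring (lucasℤ (suc (suc n))) (lucasℤ (suc n)) (lucasℤ n) ⟩
  (+ 2 * lucasℤ (suc (suc n)) - lucasℤ (suc n)) + (+ 2 * lucasℤ (suc n) - lucasℤ n)
    ≡⟨ cong₂ _+_ (fibℤ-via-lucasℤ (suc n)) (fibℤ-via-lucasℤ n) ⟩
  + 5 * fibℤ (suc n) + + 5 * fibℤ n
    ≡⟨ sym (*-distribˡ-+ (+ 5) (fibℤ (suc n)) (fibℤ n)) ⟩
  + 5 * (fibℤ (suc n) + fibℤ n)
    ≡⟨ cong (λ u → + 5 * u) (sym (fibℤ-rec n)) ⟩
  + 5 * fibℤ (suc (suc n)) ∎
  where
  ring : ∀ u v w → + 2 * (u + v) - (v + w) ≡ (+ 2 * u - v) + (+ 2 * v - w)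
  ring u v w = solve (u ∷ v ∷ w ∷ [])

fibonacciLike-+ : ∀ {X} → IsFibonacciLike X → ∀ d m →
  X (suc d ℕ.+ m) ≡ fibℤ (suc d) * X (suc m) + fibℤ d * X m
fibonacciLike-+ {X} isFib zero    m = ring (X (suc m)) (X m)
  where
  ring : ∀ u v → u ≡ 1ℤ * u + 0ℤ * v
  ring u v = solve (u ∷ v ∷ [])
fibonacciLike-+ {X} isFib (suc d) m = begin
  X (suc (suc d) ℕ.+ m)
    ≡⟨ cong (λ i → X (suc i)) (sym (ℕ.+-suc d m)) ⟩
  X (suc d ℕ.+ suc m)
    ≡⟨ fibonacciLike-+ isFib d (suc m) ⟩
  fibℤ (suc d) * X (suc (suc m)) + fibℤ d * X (suc m)
    ≡⟨ cong (λ u → fibℤ (suc d) * u + fibℤ d * X (suc m)) (recurrence isFib m) ⟩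
  fibℤ (suc d) * (X (suc m) + X m) + fibℤ d * X (suc m)
    ≡⟨ ring (fibℤ (suc d)) (fibℤ d) (X (suc m)) (X m) ⟩
  (fibℤ (suc d) + fibℤ d) * X (suc m) + fibℤ (suc d) * X m
    ≡⟨ cong (λ u → u * X (suc m) + fibℤ (suc d) * X m) (sym (fibℤ-rec d)) ⟩
  fibℤ (suc (suc d)) * X (suc m) + fibℤ (suc d) * X m ∎
  where
  ring : ∀ a b u v → a * (u + v) + b * u ≡ (a + b) * u + a * v
  ring a b u v = solve (a ∷ b ∷ u ∷ v ∷ [])

fibonacciLike-double : ∀ {X} → IsFibonacciLike X → ∀ d m →
  X (d ℕ.+ (d ℕ.+ m)) ≡ lucasℤ d * X (d ℕ.+ m) - sgn d * X m
fibonacciLike-double {X} isFib zero    m = ring (X m)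
  where
  ring : ∀ u → u ≡ + 2 * u - 1ℤ * u
  ring u = solve (u ∷ [])
fibonacciLike-double {X} isFib (suc e) m = begin
  X (suc e ℕ.+ (suc e ℕ.+ m))
    ≡⟨ fibonacciLike-+ isFib e (suc e ℕ.+ m) ⟩
  b * X (suc (suc e ℕ.+ m)) + a * X (suc e ℕ.+ m)
    ≡⟨ cong₂ (λ u v → b * u + a * v) (fibonacciLike-+ isFib (suc e) m) (fibonacciLike-+ isFib e m) ⟩
  b * (c * X₁ + b * X₀) + a * (b * X₁ + a * X₀)
    ≡⟨ ring a b c X₀ X₁ (fibℤ-rec e) ⟩
  (+ 2 * c - b) * (b * X₁ + a * X₀) - (a * c - b * b) * X₀
    ≡⟨ cong₂ (λ u v → u * (b * X₁ + a * X₀) - v * X₀) (sym (lucasℤ-via-fibℤ (suc e))) (cassini e) ⟩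
  lucasℤ (suc e) * (b * X₁ + a * X₀) - sgn (suc e) * X₀
    ≡⟨ cong (λ u → lucasℤ (suc e) * u - sgn (suc e) * X₀) (sym (fibonacciLike-+ isFib e m)) ⟩
  lucasℤ (suc e) * X (suc e ℕ.+ m) - sgn (suc e) * X m ∎
  where
  a b c X₀ X₁ : ℤ
  a = fibℤ e
  b = fibℤ (suc e)
  c = fibℤ (suc (suc e))
  X₀ = X m
  X₁ = X (suc m)
  ring : ∀ a b c X₀ X₁ → c ≡ b + a →
    b * (c * X₁ + b * X₀) + a * (b * X₁ + a * X₀) ≡ (+ 2 * c - b) * (b * X₁ + a * X₀) - (a * c - b * b) * X₀
  ring a b c X₀ X₁ refl = solve (a ∷ b ∷ X₀ ∷ X₁ ∷ [])

fibonacciLike-double-difference : ∀ {X} → IsFibonacciLike X → ∀ d m →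
  X (d ℕ.+ (d ℕ.+ m)) - sgn d * X m ≡ fibℤ d * (+ 2 * X (suc (d ℕ.+ m)) - X (d ℕ.+ m))
fibonacciLike-double-difference {X} isFib zero    m = ring (X m) (X (suc m))
  where
  ring : ∀ u v → u - 1ℤ * u ≡ 0ℤ * (+ 2 * v - u)
  ring u v = solve (u ∷ v ∷ [])
fibonacciLike-double-difference {X} isFib (suc e) m = begin
  X (suc e ℕ.+ (suc e ℕ.+ m)) - sgn (suc e) * X₀
    ≡⟨ cong₂ (λ u v → u - v * X₀) (fibonacciLike-+ isFib e (suc e ℕ.+ m)) (sym (cassini e)) ⟩
  b * X (suc (suc e ℕ.+ m)) + a * X (suc e ℕ.+ m) - (a * c - b * b) * X₀
    ≡⟨ cong₂ (λ u v → b * u + a * v - (a * c - b * b) * X₀) Y₁ Y₀ ⟩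
  b * (c * X₁ + b * X₀) + a * (b * X₁ + a * X₀) - (a * c - b * b) * X₀
    ≡⟨ ring a b c X₀ X₁ (fibℤ-rec e) ⟩
  b * (+ 2 * (c * X₁ + b * X₀) - (b * X₁ + a * X₀))
    ≡⟨ cong₂ (λ u v → b * (+ 2 * u - v)) (sym Y₁) (sym Y₀) ⟩
  b * (+ 2 * X (suc (suc e ℕ.+ m)) - X (suc e ℕ.+ m)) ∎
  where
  a b c X₀ X₁ : ℤ
  a = fibℤ e
  b = fibℤ (suc e)
  c = fibℤ (suc (suc e))
  X₀ = X m
  X₁ = X (suc m)
  Y₀ : X (suc e ℕ.+ m) ≡ b * X₁ + a * X₀
  Y₀ = fibonacciLike-+ isFib e m
  Y₁ : X (suc (suc e ℕ.+ m)) ≡ c * X₁ + b * X₀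
  Y₁ = fibonacciLike-+ isFib (suc e) m
  ring : ∀ a b c X₀ X₁ → c ≡ b + a →
    b * (c * X₁ + b * X₀) + a * (b * X₁ + a * X₀) - (a * c - b * b) * X₀
      ≡ b * (+ 2 * (c * X₁ + b * X₀) - (b * X₁ + a * X₀))
  ring a b c X₀ X₁ refl = solve (a ∷ b ∷ X₀ ∷ X₁ ∷ [])

lucasℤ-double-difference : ∀ d m →
  lucasℤ (d ℕ.+ (d ℕ.+ m)) - sgn d * lucasℤ m ≡ fibℤ d * (+ 5 * fibℤ (d ℕ.+ m))
lucasℤ-double-difference d m =
  trans (fibonacciLike-double-difference lucasℤ-isFibonacciLike d m)
        (cong (λ u → fibℤ d * u) (fibℤ-via-lucasℤ (d ℕ.+ m)))

recurrence-unique : ∀ (α : ℤ) (e : ℕ → ℤ) {u v : ℕ → ℤ} →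
  (∀ n → u (suc (suc n)) + u n ≡ α * u (suc n) + e n) →
  (∀ n → v (suc (suc n)) + v n ≡ α * v (suc n) + e n) →
  u 0 ≡ v 0 → u 1 ≡ v 1 → ∀ n → u n ≡ v n
recurrence-unique α e {u} {v} u-rec v-rec u₀≡v₀ u₁≡v₁ n = proj₁ (agree n)
  where
  agree : ∀ n → u n ≡ v n × u (suc n) ≡ v (suc n)
  agree zero    = u₀≡v₀ , u₁≡v₁
  agree (suc n) with agree n
  ... | uₙ≡vₙ , uₙ₊₁≡vₙ₊₁ = uₙ₊₁≡vₙ₊₁ , ∙-cancelʳ (u n) _ _ (begin
    u (suc (suc n)) + u n      ≡⟨ u-rec n ⟩
    α * u (suc n) + e n        ≡⟨ cong (λ z → α * z + e n) uₙ₊₁≡vₙ₊₁ ⟩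
    α * v (suc n) + e n        ≡⟨ sym (v-rec n) ⟩
    v (suc (suc n)) + v n      ≡⟨ cong (λ z → v (suc (suc n)) + z) (sym uₙ≡vₙ) ⟩
    v (suc (suc n)) + u n      ∎)

module OddMultisection (k : ℕ) where

  odd : ℕ → ℕ
  odd n = (2 ℕ.* n ℕ.+ 1) ℕ.* k

  odd-suc : ∀ n → odd (suc n) ≡ 2 ℕ.* k ℕ.+ odd n
  odd-suc n = ring n k
    where
    ring : ∀ n k → (2 ℕ.* suc n ℕ.+ 1) ℕ.* k ≡ 2 ℕ.* k ℕ.+ (2 ℕ.* n ℕ.+ 1) ℕ.* k
    ring = ℕ.solve-∀

  odd-suc-suc : ∀ n → odd (suc (suc n)) ≡ 2 ℕ.* k ℕ.+ (2 ℕ.* k ℕ.+ odd n)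
  odd-suc-suc n = trans (odd-suc (suc n)) (cong (2 ℕ.* k ℕ.+_) (odd-suc n))

  multisection-rec : ∀ {X} → IsFibonacciLike X → ∀ n →
    X (odd (suc (suc n))) + X (odd n) ≡ lucasℤ (2 ℕ.* k) * X (odd (suc n))
  multisection-rec {X} isFib n = begin
    X (odd (suc (suc n))) + X (odd n)
      ≡⟨ cong (λ i → X i + X (odd n)) (odd-suc-suc n) ⟩
    X (2k ℕ.+ (2k ℕ.+ odd n)) + X (odd n)
      ≡⟨ cong (λ u → u + X (odd n)) (fibonacciLike-double isFib 2k (odd n)) ⟩
    lucasℤ 2k * X (2k ℕ.+ odd n) - sgn 2k * X (odd n) + X (odd n)
      ≡⟨ cong (λ σ → lucasℤ 2k * X (2k ℕ.+ odd n) - σ * X (odd n) + X (odd n)) (sgn-even k) ⟩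
    lucasℤ 2k * X (2k ℕ.+ odd n) - 1ℤ * X (odd n) + X (odd n)
      ≡⟨ ring (lucasℤ 2k) (X (2k ℕ.+ odd n)) (X (odd n)) ⟩
    lucasℤ 2k * X (2k ℕ.+ odd n)
      ≡⟨ cong (λ i → lucasℤ 2k * X i) (sym (odd-suc n)) ⟩
    lucasℤ 2k * X (odd (suc n)) ∎
    where
    2k : ℕ
    2k = 2 ℕ.* k
    ring : ∀ c u v → c * u - 1ℤ * v + v ≡ c * u
    ring c u v = solve (c ∷ u ∷ v ∷ [])

  lucas-multisection-difference : ∀ n →
    lucasℤ (odd (suc (suc n))) - lucasℤ (odd n) ≡ fibℤ (2 ℕ.* k) * (+ 5 * fibℤ (odd (suc n)))
  lucas-multisection-difference n = begin
    lucasℤ (odd (suc (suc n))) - lucasℤ (odd n)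
      ≡⟨ cong₂ (λ i u → lucasℤ i - u) (odd-suc-suc n) (sym (*-identityˡ (lucasℤ (odd n)))) ⟩
    lucasℤ (2k ℕ.+ (2k ℕ.+ odd n)) - 1ℤ * lucasℤ (odd n)
      ≡⟨ cong (λ σ → lucasℤ (2k ℕ.+ (2k ℕ.+ odd n)) - σ * lucasℤ (odd n)) (sym (sgn-even k)) ⟩
    lucasℤ (2k ℕ.+ (2k ℕ.+ odd n)) - sgn 2k * lucasℤ (odd n)
      ≡⟨ lucasℤ-double-difference 2k (odd n) ⟩
    fibℤ 2k * (+ 5 * fibℤ (2k ℕ.+ odd n))
      ≡⟨ cong (λ i → fibℤ 2k * (+ 5 * fibℤ i)) (sym (odd-suc n)) ⟩
    fibℤ 2k * (+ 5 * fibℤ (odd (suc n))) ∎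
    where
    2k : ℕ
    2k = 2 ℕ.* k

  p x σ s : ℤ
  p = fibℤ k
  x = lucasℤ k
  σ = sgn k
  s = sgn (suc k)

  open BinomialSums s (x ^ 2) public

  G M : ℕ → ℤ
  G n = fibℤ (odd n)
  M n = lucasℤ (odd n)

  fib-k : fibℤ (k ℕ.+ 0) ≡ p
  fib-k = cong fibℤ (ℕ.+-identityʳ k)

  lucas-k : lucasℤ (k ℕ.+ 0) ≡ x
  lucas-k = cong lucasℤ (ℕ.+-identityʳ k)

  fib-2k : fibℤ (2 ℕ.* k) ≡ x * p
  fib-2k = begin
    fibℤ (k ℕ.+ (k ℕ.+ 0))            ≡⟨ fibonacciLike-double fibℤ-isFibonacciLike k 0 ⟩
    x * fibℤ (k ℕ.+ 0) - σ * 0ℤ       ≡⟨ cong (λ u → x * u - σ * 0ℤ) fib-k ⟩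
    x * p - σ * 0ℤ                    ≡⟨ ring x p σ ⟩
    x * p                             ∎
    where
    ring : ∀ x p σ → x * p - σ * 0ℤ ≡ x * p
    ring x p σ = solve (x ∷ p ∷ σ ∷ [])

  lucas-2k : lucasℤ (2 ℕ.* k) ≡ x * x - σ * + 2
  lucas-2k = trans (fibonacciLike-double lucasℤ-isFibonacciLike k 0) (cong (λ u → x * u - σ * + 2) lucas-k)

  fib-3k : fibℤ (3 ℕ.* k) ≡ x * (x * p) - σ * p
  fib-3k = trans (fibonacciLike-double fibℤ-isFibonacciLike k (k ℕ.+ 0))
                 (cong₂ (λ u v → x * u - σ * v) fib-2k fib-k)

  lucas-3k : lucasℤ (3 ℕ.* k) ≡ x * (x * x - σ * + 2) - σ * x
  lucas-3k = trans (fibonacciLike-double lucasℤ-isFibonacciLike k (k ℕ.+ 0))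
                   (cong₂ (λ u v → x * u - σ * v) lucas-2k lucas-k)

  lucas²-fib² : x * x - + 4 * σ ≡ + 5 * (p * p)
  lucas²-fib² = begin
    x * x - + 4 * σ                       ≡⟨ split x σ ⟩
    (x * x - σ * + 2) - σ * + 2           ≡⟨ cong (λ u → u - σ * + 2) (sym lucas-2k) ⟩
    lucasℤ (2 ℕ.* k) - σ * lucasℤ 0       ≡⟨ lucasℤ-double-difference k 0 ⟩
    p * (+ 5 * fibℤ (k ℕ.+ 0))            ≡⟨ cong (λ u → p * (+ 5 * u)) fib-k ⟩
    p * (+ 5 * p)                         ≡⟨ swap p ⟩
    + 5 * (p * p)                         ∎
    where
    split : ∀ x σ → x * x - + 4 * σ ≡ (x * x - σ * + 2) - σ * + 2
    split x σ = solve (x ∷ σ ∷ [])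
    swap : ∀ p → p * (+ 5 * p) ≡ + 5 * (p * p)
    swap p = solve (p ∷ [])

  s² : s * s ≡ 1ℤ
  s² = sgn-square (suc k)

  L₂ₖ : ℤ
  L₂ₖ = lucasℤ (2 ℕ.* k)

  -- sgn (suc k) unfolds to - 1ℤ * sgn k.
  L₂ₖ-via-s : s + s + 1ℤ * x ^ 2 ≡ L₂ₖ
  L₂ₖ-via-s = trans (ring σ x) (sym lucas-2k)
    where
    ring : ∀ σ x → - 1ℤ * σ + - 1ℤ * σ + 1ℤ * (x * (x * 1ℤ)) ≡ x * x - σ * + 2
    ring σ x = solve (σ ∷ x ∷ [])

  B-rec-L₂ₖ : ∀ n → B (suc (suc n)) + B n ≡ L₂ₖ * B (suc n)
  B-rec-L₂ₖ n = begin
    B₂ + B₀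
      ≡⟨ cong (λ z → B₂ + z) (sym (*-identityˡ B₀)) ⟩
    B₂ + 1ℤ * B₀
      ≡⟨ subst (λ α → B₂ + α * B₀ ≡ (s + s) * B₁ + α * x ^ 2 * B₁) s² (B-rec n) ⟩
    (s + s) * B₁ + 1ℤ * x ^ 2 * B₁
      ≡⟨ ring s (x ^ 2) B₁ ⟩
    (s + s + 1ℤ * x ^ 2) * B₁
      ≡⟨ cong (λ z → z * B₁) L₂ₖ-via-s ⟩
    L₂ₖ * B₁ ∎
    where
    B₀ B₁ B₂ : ℤ
    B₀ = B n
    B₁ = B (suc n)
    B₂ = B (suc (suc n))
    ring : ∀ s t B → (s + s) * B + 1ℤ * t * B ≡ (s + s + 1ℤ * t) * B
    ring s t B = solve (s ∷ t ∷ B ∷ [])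

  S-rec-L₂ₖ : ∀ n → S (suc (suc n)) + S n ≡ L₂ₖ * S (suc n) + x ^ 2 * B (suc n)
  S-rec-L₂ₖ n = begin
    S₂ + S₀
      ≡⟨ cong (λ z → S₂ + z) (sym (*-identityˡ S₀)) ⟩
    S₂ + 1ℤ * S₀
      ≡⟨ subst (λ α → S₂ + α * S₀ ≡ (s + s) * S₁ + α * x ^ 2 * (S₁ + B₁)) s² (S-rec n) ⟩
    (s + s) * S₁ + 1ℤ * x ^ 2 * (S₁ + B₁)
      ≡⟨ ring s (x ^ 2) S₁ B₁ ⟩
    (s + s + 1ℤ * x ^ 2) * S₁ + x ^ 2 * B₁
      ≡⟨ cong (λ z → z * S₁ + x ^ 2 * B₁) L₂ₖ-via-s ⟩
    L₂ₖ * S₁ + x ^ 2 * B₁ ∎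
    where
    S₀ S₁ S₂ B₁ : ℤ
    S₀ = S n
    S₁ = S (suc n)
    S₂ = S (suc (suc n))
    B₁ = B (suc n)
    ring : ∀ s t S B → (s + s) * S + 1ℤ * t * (S + B) ≡ (s + s + 1ℤ * t) * S + t * B
    ring s t S B = solve (s ∷ t ∷ S ∷ B ∷ [])

  fib*B≡G : ∀ n → p * B n ≡ G n
  fib*B≡G = recurrence-unique L₂ₖ (λ _ → 0ℤ) p*B-rec G-rec (trans (*-identityʳ p) (sym fib-k)) base₁
    where
    p*B-rec : ∀ n → p * B (suc (suc n)) + p * B n ≡ L₂ₖ * (p * B (suc n)) + 0ℤ
    p*B-rec n = begin
      p * B (suc (suc n)) + p * B n   ≡⟨ sym (*-distribˡ-+ p _ _) ⟩
      p * (B (suc (suc n)) + B n)     ≡⟨ cong (λ z → p * z) (B-rec-L₂ₖ n) ⟩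
      p * (L₂ₖ * B (suc n))           ≡⟨ ring p L₂ₖ (B (suc n)) ⟩
      L₂ₖ * (p * B (suc n)) + 0ℤ      ∎
      where
      ring : ∀ p c B → p * (c * B) ≡ c * (p * B) + 0ℤ
      ring p c B = solve (p ∷ c ∷ B ∷ [])
    G-rec : ∀ n → G (suc (suc n)) + G n ≡ L₂ₖ * G (suc n) + 0ℤ
    G-rec n = trans (multisection-rec fibℤ-isFibonacciLike n) (sym (+-identityʳ _))
    base₁ : p * B 1 ≡ G 1
    base₁ = begin
      p * B 1                        ≡⟨ cong (λ z → p * z) B-one ⟩
      p * (s + s * s * x ^ 2)        ≡⟨ cong (λ α → p * (s + α * x ^ 2)) s² ⟩
      p * (s + 1ℤ * x ^ 2)           ≡⟨ ring p x σ ⟩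
      x * (x * p) - σ * p            ≡⟨ sym fib-3k ⟩
      G 1                            ∎
      where
      ring : ∀ p x σ → p * (- 1ℤ * σ + 1ℤ * (x * (x * 1ℤ))) ≡ x * (x * p) - σ * p
      ring p x σ = solve (p ∷ x ∷ σ ∷ [])

  odd-coefficient : ∀ n → + (2 ℕ.* suc n ℕ.+ 1) ≡ + 2 + + (2 ℕ.* n ℕ.+ 1)
  odd-coefficient n = cong (λ i → + (i ℕ.+ 1)) (ℕ.*-suc 2 n)

  S-identity : ∀ n → + 10 * (p ^ 3 * S n) ≡ + (2 ℕ.* n ℕ.+ 1) * fibℤ (2 ℕ.* k) * M n - G n * x ^ 2
  S-identity = recurrence-unique L₂ₖ e lhs-rec rhs-rec base₀ base₁
    where
    f : ℤ
    f = fibℤ (2 ℕ.* k)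
    e : ℕ → ℤ
    e n = + 10 * (f * f) * G (suc n)

    lhs-rec : ∀ n → + 10 * (p ^ 3 * S (suc (suc n))) + + 10 * (p ^ 3 * S n)
                  ≡ L₂ₖ * (+ 10 * (p ^ 3 * S (suc n))) + e n
    lhs-rec n = begin
      + 10 * (p ^ 3 * S (suc (suc n))) + + 10 * (p ^ 3 * S n)
        ≡⟨ factor p (S (suc (suc n))) (S n) ⟩
      + 10 * (p ^ 3 * (S (suc (suc n)) + S n))
        ≡⟨ cong (λ z → + 10 * (p ^ 3 * z)) (S-rec-L₂ₖ n) ⟩
      + 10 * (p ^ 3 * (L₂ₖ * S (suc n) + x ^ 2 * B (suc n)))
        ≡⟨ expand p x L₂ₖ (S (suc n)) (B (suc n)) ⟩
      L₂ₖ * (+ 10 * (p ^ 3 * S (suc n))) + + 10 * ((x * p) * (x * p)) * (p * B (suc n))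
        ≡⟨ cong₂ (λ u v → L₂ₖ * (+ 10 * (p ^ 3 * S (suc n))) + + 10 * (u * u) * v)
                 (sym fib-2k) (fib*B≡G (suc n)) ⟩
      L₂ₖ * (+ 10 * (p ^ 3 * S (suc n))) + e n ∎
      where
      factor : ∀ p S₂ S₀ → + 10 * (p * (p * (p * 1ℤ)) * S₂) + + 10 * (p * (p * (p * 1ℤ)) * S₀)
                         ≡ + 10 * (p * (p * (p * 1ℤ)) * (S₂ + S₀))
      factor p S₂ S₀ = solve (p ∷ S₂ ∷ S₀ ∷ [])
      expand : ∀ p x c S B → + 10 * (p * (p * (p * 1ℤ)) * (c * S + x * (x * 1ℤ) * B))
                           ≡ c * (+ 10 * (p * (p * (p * 1ℤ)) * S)) + + 10 * ((x * p) * (x * p)) * (p * B)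
      expand p x c S B = solve (p ∷ x ∷ c ∷ S ∷ B ∷ [])

    rhs-rec : ∀ n → (+ (2 ℕ.* suc (suc n) ℕ.+ 1) * f * M (suc (suc n)) - G (suc (suc n)) * x ^ 2)
                    + (+ (2 ℕ.* n ℕ.+ 1) * f * M n - G n * x ^ 2)
                  ≡ L₂ₖ * (+ (2 ℕ.* suc n ℕ.+ 1) * f * M (suc n) - G (suc n) * x ^ 2) + e n
    rhs-rec n = begin
      (+ (2 ℕ.* suc (suc n) ℕ.+ 1) * f * M (suc (suc n)) - G (suc (suc n)) * x ^ 2) + (N * f * M n - G n * x ^ 2)
        ≡⟨ cong (λ K → (K * f * M (suc (suc n)) - G (suc (suc n)) * x ^ 2) + (N * f * M n - G n * x ^ 2))
                (trans (odd-coefficient (suc n)) (cong (λ K → + 2 + K) (odd-coefficient n))) ⟩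
      ((+ 2 + (+ 2 + N)) * f * M (suc (suc n)) - G (suc (suc n)) * x ^ 2) + (N * f * M n - G n * x ^ 2)
        ≡⟨ combine N f (x ^ 2) L₂ₖ (M n) (M (suc n)) (M (suc (suc n))) (G n) (G (suc n)) (G (suc (suc n)))
                   (multisection-rec lucasℤ-isFibonacciLike n) (lucas-multisection-difference n)
                   (multisection-rec fibℤ-isFibonacciLike n) ⟩
      L₂ₖ * ((+ 2 + N) * f * M (suc n) - G (suc n) * x ^ 2) + e n
        ≡⟨ cong (λ K → L₂ₖ * (K * f * M (suc n) - G (suc n) * x ^ 2) + e n) (sym (odd-coefficient n)) ⟩
      L₂ₖ * (+ (2 ℕ.* suc n ℕ.+ 1) * f * M (suc n) - G (suc n) * x ^ 2) + e n ∎
      where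
      N : ℤ
      N = + (2 ℕ.* n ℕ.+ 1)
      combine : ∀ N f t c M₀ M₁ M₂ G₀ G₁ G₂ →
        M₂ + M₀ ≡ c * M₁ → M₂ - M₀ ≡ f * (+ 5 * G₁) → G₂ + G₀ ≡ c * G₁ →
        ((+ 2 + (+ 2 + N)) * f * M₂ - G₂ * t) + (N * f * M₀ - G₀ * t)
          ≡ c * ((+ 2 + N) * f * M₁ - G₁ * t) + + 10 * (f * f) * G₁
      combine N f t c M₀ M₁ M₂ G₀ G₁ G₂ M-rec M-diff G-rec = begin
        ((+ 2 + (+ 2 + N)) * f * M₂ - G₂ * t) + (N * f * M₀ - G₀ * t)
          ≡⟨ solve (N ∷ f ∷ t ∷ M₀ ∷ M₂ ∷ G₀ ∷ G₂ ∷ []) ⟩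
        (+ 2 + N) * f * (M₂ + M₀) + + 2 * f * (M₂ - M₀) - (G₂ + G₀) * t
          ≡⟨ cong₂ (λ u v → (+ 2 + N) * f * u + + 2 * f * v - (G₂ + G₀) * t) M-rec M-diff ⟩
        (+ 2 + N) * f * (c * M₁) + + 2 * f * (f * (+ 5 * G₁)) - (G₂ + G₀) * t
          ≡⟨ cong (λ u → (+ 2 + N) * f * (c * M₁) + + 2 * f * (f * (+ 5 * G₁)) - u * t) G-rec ⟩
        (+ 2 + N) * f * (c * M₁) + + 2 * f * (f * (+ 5 * G₁)) - c * G₁ * t
          ≡⟨ solve (N ∷ f ∷ t ∷ c ∷ M₁ ∷ G₁ ∷ []) ⟩
        c * ((+ 2 + N) * f * M₁ - G₁ * t) + + 10 * (f * f) * G₁ ∎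

    base₀ : + 10 * (p ^ 3 * S 0) ≡ + 1 * f * M 0 - G 0 * x ^ 2
    base₀ = begin
      + 10 * (p ^ 3 * 0ℤ)                   ≡⟨ ring p x ⟩
      + 1 * (x * p) * x - p * x ^ 2         ≡⟨ cong₂ (λ u v → + 1 * u * v - p * x ^ 2) (sym fib-2k) (sym lucas-k) ⟩
      + 1 * f * M 0 - p * x ^ 2             ≡⟨ cong (λ u → + 1 * f * M 0 - u * x ^ 2) (sym fib-k) ⟩
      + 1 * f * M 0 - G 0 * x ^ 2           ∎
      where
      ring : ∀ p x → + 10 * (p * (p * (p * 1ℤ)) * 0ℤ) ≡ + 1 * (x * p) * x - p * (x * (x * 1ℤ))
      ring p x = solve (p ∷ x ∷ [])

    base₁ : + 10 * (p ^ 3 * S 1) ≡ + 3 * f * M 1 - G 1 * x ^ 2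
    base₁ = begin
      + 10 * (p ^ 3 * S 1)
        ≡⟨ cong (λ z → + 10 * (p ^ 3 * z)) S-one ⟩
      + 10 * (p ^ 3 * (s * s * x ^ 2))
        ≡⟨ cong (λ α → + 10 * (p ^ 3 * (α * x ^ 2))) s² ⟩
      + 10 * (p ^ 3 * (1ℤ * x ^ 2))
        ≡⟨ regroup p x ⟩
      + 2 * (x * x) * p * (+ 5 * (p * p))
        ≡⟨ cong (λ z → + 2 * (x * x) * p * z) (sym lucas²-fib²) ⟩
      + 2 * (x * x) * p * (x * x - + 4 * σ)
        ≡⟨ expand p x σ ⟩
      + 3 * (x * p) * (x * (x * x - σ * + 2) - σ * x) - (x * (x * p) - σ * p) * x ^ 2
        ≡⟨ cong₂ (λ u v → + 3 * u * v - (x * (x * p) - σ * p) * x ^ 2) (sym fib-2k) (sym lucas-3k) ⟩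
      + 3 * f * M 1 - (x * (x * p) - σ * p) * x ^ 2
        ≡⟨ cong (λ u → + 3 * f * M 1 - u * x ^ 2) (sym fib-3k) ⟩
      + 3 * f * M 1 - G 1 * x ^ 2 ∎
      where
      regroup : ∀ p x → + 10 * (p * (p * (p * 1ℤ)) * (1ℤ * (x * (x * 1ℤ))))
                      ≡ + 2 * (x * x) * p * (+ 5 * (p * p))
      regroup p x = solve (p ∷ x ∷ [])
      expand : ∀ p x σ → + 2 * (x * x) * p * (x * x - + 4 * σ)
                       ≡ + 3 * (x * p) * (x * (x * x - σ * + 2) - σ * x) - (x * (x * p) - σ * p) * (x * (x * 1ℤ))
      expand p x σ = solve (p ∷ x ∷ σ ∷ [])

  statement-summand : ∀ n j →
    sgn ((k ℕ.+ 1) ℕ.* (n ℕ.+ j)) * + j * + ((n ℕ.+ j) C (2 ℕ.* j)) * x ^ (2 ℕ.* j) ≡ weighted n j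
  statement-summand n j = begin
    sgn ((k ℕ.+ 1) ℕ.* (n ℕ.+ j)) * + j * C′ * x ^ (2 ℕ.* j)
      ≡⟨ cong₂ (λ u v → u * + j * C′ * v) sign-power (sym (^-*-assoc x 2 j)) ⟩
    s ^ (n ℕ.+ j) * + j * C′ * (x ^ 2) ^ j
      ≡⟨ ring (s ^ (n ℕ.+ j)) (+ j) C′ ((x ^ 2) ^ j) ⟩
    + j * (s ^ (n ℕ.+ j) * C′ * (x ^ 2) ^ j) ∎
    where
    C′ : ℤ
    C′ = + ((n ℕ.+ j) C (2 ℕ.* j))
    sign-power : sgn ((k ℕ.+ 1) ℕ.* (n ℕ.+ j)) ≡ s ^ (n ℕ.+ j)
    sign-power = trans (cong (λ i → sgn (i ℕ.* (n ℕ.+ j))) (ℕ.+-comm k 1))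
                       (sym (^-*-assoc (- 1ℤ) (suc k) (n ℕ.+ j)))
    ring : ∀ σ J C X → σ * J * C * X ≡ J * (σ * C * X)
    ring σ J C X = solve (σ ∷ J ∷ C ∷ X ∷ [])

proposition4 : (k n : ℕ) →
    + 10 * ((+ fib k) ^ 3 * sumTo n (λ j → sgn ((k Data.Nat.+ 1) Data.Nat.* (n Data.Nat.+ j)) * (+ j) * (+ ((n Data.Nat.+ j) C (2 Data.Nat.* j))) * (+ lucas k) ^ (2 Data.Nat.* j)))
      ≡ + (2 Data.Nat.* n Data.Nat.+ 1) * + fib (2 Data.Nat.* k) * + lucas ((2 Data.Nat.* n Data.Nat.+ 1) Data.Nat.* k)
        - + fib ((2 Data.Nat.* n Data.Nat.+ 1) Data.Nat.* k) * (+ lucas k) ^ 2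
proposition4 k n = begin
  + 10 * (p ^ 3 * sumTo n (λ j → sgn ((k ℕ.+ 1) ℕ.* (n ℕ.+ j)) * + j * + ((n ℕ.+ j) C (2 ℕ.* j)) * x ^ (2 ℕ.* j)))
    ≡⟨ cong (λ z → + 10 * (p ^ 3 * z)) (sumTo-cong n (statement-summand n)) ⟩
  + 10 * (p ^ 3 * S n)
    ≡⟨ S-identity n ⟩
  + (2 ℕ.* n ℕ.+ 1) * fibℤ (2 ℕ.* k) * M n - G n * x ^ 2 ∎
  where
  open OddMultisection k
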